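{- Let $p$ be a prime and let $X$ be an infinite transitive $G$-graph with $G'\cong\mathbb{Z}_p$. Let $\overline{\gamma}:\ldots,\overline{v}_{ -1},\overline{v}_0,\overline{v}_1,\ldots$ be a two-way hamiltonian path in $X/G'$, let $(v_i)_{i\in\mathbb{Z}}$ be a lifting of $\overline{\gamma}$ (so $v_i\in\pi^{ -1}(\overline{v}_i)$ and $v_i$ adjacent to $v_{i+1}$), and let $(e_\ell)_{\ell\in\mathbb{Z}}$ be a sequence of edges of $X/G'$ aligned with $\overline{\gamma}$ such that, writing $e_\ell=(\overline{v}_a,\overline{v}_b)$ with $a<b$, there exist $h\neq h'$ in $G'$ with $hv_a$ adjacent to $h'v_b$. Then for every $\ell$ and every vertex $u$ in the entrance of the block $B(e_\ell)$, there is a hamiltonian path of $B(e_\ell)$ starting at $u$ and ending at a vertex in the exit of $B(e_\ell)$.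
   Context: A $G$-graph is a graph $X$ with an injective homomorphism $G\to\mathrm{Aut}(X)$; transitive means $G$ acts transitively on $V(X)$. $G'$ is the commutator subgroup. $X/G'$ has the $G'$-orbits as vertices, two orbits adjacent iff some edge of $X$ joins them; $\pi$ is the quotient map. A two-way hamiltonian path is a two-way infinite sequence of vertices containing every vertex exactly once with consecutive vertices adjacent. A sequence $(e_\ell=(x_\ell,y_\ell))$ of edges is aligned with $\overline{\gamma}$ if no $e_\ell$ is an edge of $\overline{\gamma}$ and for every $\ell$ there are $j$, $k\ge1$ with $x_\ell=\overline{v}_j$, $y_\ell=\overline{v}_{j+k}$, $x_{\ell+1}=\overline{v}_{j+k+1}$. For $e_\ell=(\overline{v}_a,\overline{v}_b)$, $a<b$, the block $B(e_\ell)$ is the subgraph of $X$ induced on $\bigcup_{a\le i\le b}\pi^{ -1}(\overline{v}_i)$, with entrance $\pi^{ -1}(\overline{v}_a)$ and exit $\pi^{ -1}(\overline{v}_b)$. -}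

module Defs where

open import Level using (Level; _⊔_; suc)
open import Algebra.Bundles using (Group)
open import Data.Nat as ℕ using (ℕ; NonZero)
open import Data.Nat.DivMod using (_mod_)
open import Data.Fin using (Fin; toℕ)
open import Data.Integer as ℤ using (ℤ; _≤_; _<_)
open import Data.List using (List; head; last)
open import Data.List.Relation.Unary.Unique.Propositional using (Unique)
open import Data.List.Relation.Unary.All using (All)
open import Data.List.Relation.Unary.Linked using (Linked)
open import Data.List.Membership.Propositional using (_∈_)
open import Data.Maybe using (just)
open import Data.Product using (Σ; ∃; ∃-syntax; _×_)
open import Relation.Nullary using (¬_)
open import Relation.Binary.PropositionalEquality using (_≡_)

record Graph (v e : Level) : Set (suc (v ⊔ e)) where
  field
    V     : Set v
    E     : V → V → Set e
    E-sym : ∀ {x y} → E x y → E y x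
    E-irr : ∀ {x} → ¬ E x x

Infinite : ∀ {v e} → Graph v e → Set v
Infinite X = ¬ (Σ ℕ λ n → Σ (Fin n → Graph.V X) λ f → ∀ x → ∃ λ i → f i ≡ x)

_+ₘ_ : ∀ {n} .{{_ : NonZero n}} → Fin n → Fin n → Fin n
_+ₘ_ {n} i j = (toℕ i ℕ.+ toℕ j) mod n

module _ {c ℓ} (G : Group c ℓ) where
  open Group G

  comm : Carrier → Carrier → Carrier
  comm g h = ((g ⁻¹ ∙ h ⁻¹) ∙ g) ∙ h

  data InG' : Carrier → Set (c ⊔ ℓ) where
    g'-comm : ∀ g h → InG' (comm g h)
    g'-ε    : InG' ε
    g'-∙    : ∀ {x y} → InG' x → InG' y → InG' (x ∙ y)
    g'-⁻¹   : ∀ {x} → InG' x → InG' (x ⁻¹)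
    g'-≈    : ∀ {x y} → x ≈ y → InG' x → InG' y

  G'≅ℤ : (p : ℕ) .{{_ : NonZero p}} → Set (c ⊔ ℓ)
  G'≅ℤ p = Σ (Fin p → Carrier) λ φ →
      (∀ i → InG' (φ i))
    × (∀ i j → φ (i +ₘ j) ≈ φ i ∙ φ j)
    × (∀ i j → φ i ≈ φ j → i ≡ j)
    × (∀ x → InG' x → ∃ λ i → φ i ≈ x)

-- X is a G-graph: an injective homomorphism G → Aut(X), i.e. a faithful
-- action of G on V(X) by graph automorphisms.
record GGraph {c ℓ v e} (G : Group c ℓ) (X : Graph v e) : Set (c ⊔ ℓ ⊔ v ⊔ e) where
  open Group G
  open Graph X
  field
    act       : Carrier → V → V
    act-≈     : ∀ {g h} → g ≈ h → ∀ x → act g x ≡ act h x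
    act-ε     : ∀ x → act ε x ≡ x
    act-∙     : ∀ g h x → act (g ∙ h) x ≡ act g (act h x)
    act-adj   : ∀ g {x y} → E x y → E (act g x) (act g y)
    faithful  : ∀ g → (∀ x → act g x ≡ x) → g ≈ ε

module Setup {c ℓ v e} {G : Group c ℓ} {X : Graph v e} (A : GGraph G X) where
  open Group G
  open Graph X
  open GGraph A

  Transitive : Set (c ⊔ v)
  Transitive = ∀ x y → ∃ λ g → act g x ≡ y

  -- x lies in the G'-orbit of y, i.e. π x = π y
  SameOrbit : V → V → Set (c ⊔ ℓ ⊔ v)
  SameOrbit y x = ∃ λ h → InG' G h × act h y ≡ x

  -- (v_i) is a lifting of a two-way hamiltonian path γ̄ of X/G' where
  -- γ̄_i = π(v_i): the orbits π(v_i) are pairwise distinct, cover V(X),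
  -- and v_i is adjacent to v_{i+1}.
  LiftedHamPath : (ℤ → V) → Set (c ⊔ ℓ ⊔ v ⊔ e)
  LiftedHamPath w =
      (∀ x → ∃ λ i → SameOrbit (w i) x)
    × (∀ i j → SameOrbit (w i) (w j) → i ≡ j)
    × (∀ i → E (w i) (w (ℤ.suc i)))

  -- adjacency in X/G' of π(x) and π(y)
  QAdj : V → V → Set (c ⊔ ℓ ⊔ v ⊔ e)
  QAdj x y = ∃[ x' ] ∃[ y' ] SameOrbit x x' × SameOrbit y y' × E x' y'

  -- (e_ℓ) = (π(w (a ℓ)), π(w (b ℓ))) is a sequence of edges of X/G'
  -- aligned with γ̄ (e_ℓ = (γ̄_{a ℓ}, γ̄_{b ℓ}) with b ℓ = a ℓ + k, k ≥ 1,
  -- not an edge of γ̄, and x_{ℓ+1} = γ̄_{b ℓ + 1}).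
  Aligned : (ℤ → V) → (ℤ → ℤ) → (ℤ → ℤ) → Set (c ⊔ ℓ ⊔ v ⊔ e)
  Aligned w a b = ∀ l →
      QAdj (w (a l)) (w (b l))
    × a l < b l
    × ¬ (b l ≡ ℤ.suc (a l))
    × a (ℤ.suc l) ≡ ℤ.suc (b l)

  -- vertex x lies in the block on γ̄_lo, ..., γ̄_hi
  InBlock : (ℤ → V) → ℤ → ℤ → V → Set (c ⊔ ℓ ⊔ v)
  InBlock w lo hi x = ∃ λ i → lo ≤ i × i ≤ hi × SameOrbit (w i) x

  -- a hamiltonian path of the block B (induced subgraph on the block)
  -- from u to some vertex in the exit π⁻¹(γ̄_hi)
  BlockHamPath : (ℤ → V) → ℤ → ℤ → V → Set (c ⊔ ℓ ⊔ v ⊔ e)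
  BlockHamPath w lo hi u = Σ (List V) λ xs → Σ V λ z →
      head xs ≡ just u
    × last xs ≡ just z
    × SameOrbit (w hi) z
    × Unique xs
    × All (InBlock w lo hi) xs
    × (∀ x → InBlock w lo hi x → x ∈ xs)
    × Linked E xs

{-# OPTIONS --safe #-}
module Submission where

-- Let u = x v_a and c = h′⁻¹ h, a nontrivial element of G' ≅ ℤ_p. As p is prime, c generates
-- G', and G' acts semiregularly on V(X): a nontrivial element fixing a vertex would, through
-- its conjugates (which are its powers) and transitivity, fix every vertex, contradicting
-- faithfulness. So the block is the disjoint union of the p translates
-- x cᵏ v_a, …, x cᵏ v_b (k < p) of the lifted segment, and the edge h v_a ~ h′ v_b moved by
-- x cᵏ h′⁻¹ joins the end of the k-th translate to the start of the next. Walking through the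
-- translates in turn is the hamiltonian path.

open import Defs
open import Algebra.Bundles using (Group)
open import Data.Nat using (ℕ; NonZero)
open import Data.Nat.Primality using (Prime)
open import Data.Integer using (ℤ)
open import Data.Product using (Σ; ∃; _×_)
open import Relation.Nullary using (¬_)

import Algebra.Properties.Group as GroupProperties
import Algebra.Properties.Monoid.Mult as MonoidMult
open import Data.Nat using (zero; suc; _+_; _*_; _∸_; _≤_; _<_; z≤n; s≤s; pred; >-nonZero⁻¹)
import Data.Nat.Properties as ℕ
open import Data.Nat.DivMod
  using (_/_; _%_; _mod_; m≡m%n+[m/n]*n; [m+kn]%n≡m%n; m≤n⇒m%n≡m; m<n⇒m%n≡m; m%n<n;
         %-distribˡ-+; m%n%n≡m%n; +-distrib-/-∣ʳ; m<n⇒m/n≡0; m*n/n≡m; m<n*o⇒m/o<n)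
open import Data.Nat.Divisibility using (_∣_; n∣m*n; >⇒∤; m%n≡0⇒n∣m; n∣m⇒m%n≡0)
open import Data.Nat.Primality using (euclidsLemma)
import Data.Integer as ℤ
open import Data.Integer using (+_)
import Data.Integer.Properties as ℤ
open import Data.Integer.Tactic.RingSolver using (solve-∀)
open import Data.Fin using (Fin; toℕ; punchOut)
open import Data.Fin.Properties
  using (_≟_; toℕ-fromℕ<; toℕ<n; toℕ-injective; any?; punchOut-injective; <⇒notInjective)
open import Data.List using (List; head; last; applyUpTo)
open import Data.List.Membership.Propositional using (_∈_)
open import Data.List.Relation.Unary.All as All using (All)
import Data.List.Relation.Unary.All.Properties as All
import Data.List.Relation.Unary.Any.Properties as Any
open import Data.List.Relation.Unary.Linked using (Linked)
import Data.List.Relation.Unary.Linked.Properties as Linked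
open import Data.List.Relation.Unary.Unique.Propositional using (Unique)
import Data.List.Relation.Unary.Unique.Propositional.Properties as Unique
open import Data.Maybe using (just)
open import Data.Product using (proj₁; proj₂; _,_; ∃₂)
open import Data.Sum using (inj₁; inj₂; [_,_])
open import Function using (_∘_)
open import Function.Definitions using (Injective)
open import Relation.Nullary using (yes; no; Dec; contradiction)
import Relation.Nullary.Decidable as Dec
open import Relation.Binary using (tri<; tri≈; tri>)
open import Relation.Binary.PropositionalEquality as ≡ using (_≡_; cong; cong₂; subst; subst₂)

module _ {a} {A : Set a} where

  last-applyUpTo : ∀ (f : ℕ → A) n → last (applyUpTo f (suc n)) ≡ just (f n)
  last-applyUpTo f zero    = ≡.refl
  last-applyUpTo f (suc n) = last-applyUpTo (f ∘ suc) n

  -- Rows have columns 0 … n; cell k t sits in row k, column t.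
  rowMajor : (ℕ → ℕ → A) → (rows n : ℕ) → List A
  rowMajor cell rows n = applyUpTo (λ m → cell (m / suc n) (m % suc n)) (rows * suc n)

  module _ (cell : ℕ → ℕ → A) (n : ℕ) where

    private
      entry : ℕ → A
      entry m = cell (m / suc n) (m % suc n)

      entry-cell : ∀ k {t} → t ≤ n → entry (t + k * suc n) ≡ cell k t
      entry-cell k {t} t≤n = cong₂ cell quotient remainder
        where
        open ≡.≡-Reasoning
        quotient : (t + k * suc n) / suc n ≡ k
        quotient = begin
          (t + k * suc n) / suc n           ≡⟨ +-distrib-/-∣ʳ t (n∣m*n k) ⟩
          t / suc n + k * suc n / suc n     ≡⟨ cong₂ _+_ (m<n⇒m/n≡0 (s≤s t≤n)) (m*n/n≡m k (suc n)) ⟩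
          k                                 ∎
        remainder : (t + k * suc n) % suc n ≡ t
        remainder = ≡.trans ([m+kn]%n≡m%n t k (suc n)) (m≤n⇒m%n≡m t≤n)

      index : ∀ m → m ≡ m % suc n + m / suc n * suc n
      index m = m≡m%n+[m/n]*n m (suc n)

    head-rowMajor : ∀ rows .{{_ : NonZero rows}} → head (rowMajor cell rows n) ≡ just (cell 0 0)
    head-rowMajor (suc r) = ≡.refl

    last-rowMajor : ∀ rows .{{_ : NonZero rows}} →
                    last (rowMajor cell rows n) ≡ just (cell (pred rows) n)
    last-rowMajor (suc r) =
      ≡.trans (last-applyUpTo entry (n + r * suc n)) (cong just (entry-cell r ℕ.≤-refl))

    ∈-rowMajor : ∀ {rows k t} → k < rows → t ≤ n → cell k t ∈ rowMajor cell rows n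
    ∈-rowMajor {rows} {k} {t} k<rows t≤n =
      Any.applyUpTo⁺ entry (≡.sym (entry-cell k t≤n))
        (ℕ.<-≤-trans (ℕ.+-monoˡ-< (k * suc n) (s≤s t≤n)) (ℕ.*-monoˡ-≤ (suc n) k<rows))

    rowMajor-All : ∀ {p} {P : A → Set p} rows → (∀ {k t} → k < rows → t ≤ n → P (cell k t)) →
                   All P (rowMajor cell rows n)
    rowMajor-All rows P-cell = All.applyUpTo⁺₁ entry (rows * suc n) λ {m} m<M →
      P-cell (m<n*o⇒m/o<n m<M) (ℕ.≤-pred (m%n<n m (suc n)))

    rowMajor-Unique : ∀ rows →
      (∀ {k k′ t t′} → k < rows → k′ < rows → t ≤ n → t′ ≤ n → cell k t ≡ cell k′ t′ → k ≡ k′ × t ≡ t′) →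
      Unique (rowMajor cell rows n)
    rowMajor-Unique rows cell-injective = Unique.applyUpTo⁺₁ entry (rows * suc n) λ {i} {j} i<j j<M eq →
      let k≡k′ , t≡t′ = cell-injective (m<n*o⇒m/o<n (ℕ.<-trans i<j j<M)) (m<n*o⇒m/o<n j<M)
                          (ℕ.≤-pred (m%n<n i (suc n))) (ℕ.≤-pred (m%n<n j (suc n))) eq
      in ℕ.<⇒≢ i<j (≡.trans (index i)
           (≡.trans (cong₂ (λ t k → t + k * suc n) t≡t′ k≡k′) (≡.sym (index j))))

    rowMajor-Linked : ∀ {r} {R : A → A → Set r} rows →
      (∀ k {t} → t < n → R (cell k t) (cell k (suc t))) →
      (∀ k → R (cell k n) (cell (suc k) 0)) →
      Linked R (rowMajor cell rows n)
    rowMajor-Linked {R = R} rows along down = Linked.applyUpTo⁺₂ entry (rows * suc n) λ m →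
      subst (λ m → R (entry m) (entry (suc m))) (≡.sym (index m))
        (step (m / suc n) (ℕ.≤-pred (m%n<n m (suc n))))
      where
      -- suc (n + k * suc n) is definitionally 0 + suc k * suc n, the start of the next row.
      step : ∀ k {t} → t ≤ n → R (entry (t + k * suc n)) (entry (suc t + k * suc n))
      step k t≤n with ℕ.m≤n⇒m<n∨m≡n t≤n
      ... | inj₁ t<n  = subst₂ R (≡.sym (entry-cell k t≤n)) (≡.sym (entry-cell k t<n)) (along k t<n)
      ... | inj₂ ≡.refl = subst₂ R (≡.sym (entry-cell k t≤n)) (≡.sym (entry-cell (suc k) z≤n)) (down k)

module _ {c ℓ} (G : Group c ℓ) where
  open Group G
  open GroupProperties G using (\\-leftDividesˡ)
  open MonoidMult monoid using (×-homo-+; ×-homo-1) renaming (_×_ to _·_)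
  open import Relation.Binary.Reasoning.Setoid setoid

  ·-G' : ∀ {x} → InG' G x → ∀ k → InG' G (k · x)
  ·-G' x∈G' zero    = g'-ε
  ·-G' x∈G' (suc k) = g'-∙ x∈G' (·-G' x∈G' k)

  ·-sucʳ : ∀ x k → suc k · x ≈ k · x ∙ x
  ·-sucʳ x k = begin
    suc k · x        ≡⟨ cong (_· x) (ℕ.+-comm 1 k) ⟩
    (k + 1) · x      ≈⟨ ×-homo-+ x k 1 ⟩
    k · x ∙ 1 · x    ≈⟨ ∙-congˡ (×-homo-1 x) ⟩
    k · x ∙ x        ∎

  \\≈ε⇒≈ : ∀ {g h} → g \\ h ≈ ε → h ≈ g
  \\≈ε⇒≈ {g} {h} g\\h≈ε = begin
    h             ≈⟨ \\-leftDividesˡ g h ⟨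
    g ∙ (g \\ h)  ≈⟨ ∙-congˡ g\\h≈ε ⟩
    g ∙ ε         ≈⟨ identityʳ g ⟩
    g             ∎

  -- t⁻¹ g t = g [g,t]
  conjugate-G' : ∀ {g} → InG' G g → ∀ t → InG' G (t \\ (g ∙ t))
  conjugate-G' {g} g∈G' t = g'-≈ g[g,t]≈t⁻¹gt (g'-∙ g∈G' (g'-comm g t))
    where
    g[g,t]≈t⁻¹gt : g ∙ comm G g t ≈ t \\ (g ∙ t)
    g[g,t]≈t⁻¹gt = begin
      g ∙ (((g ⁻¹ ∙ t ⁻¹) ∙ g) ∙ t)    ≈⟨ assoc _ _ _ ⟨
      (g ∙ ((g ⁻¹ ∙ t ⁻¹) ∙ g)) ∙ t    ≈⟨ ∙-congʳ (∙-congˡ (assoc _ _ _)) ⟩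
      (g ∙ (g \\ (t ⁻¹ ∙ g))) ∙ t      ≈⟨ ∙-congʳ (\\-leftDividesˡ g _) ⟩
      (t ⁻¹ ∙ g) ∙ t                   ≈⟨ assoc _ _ _ ⟩
      t \\ (g ∙ t)                     ∎

injective⇒surjective : ∀ {n} (f : Fin n → Fin n) → Injective _≡_ _≡_ f → ∀ j → ∃ λ i → f i ≡ j
injective⇒surjective {suc n} f f-injective j with any? (λ i → f i ≟ j)
... | yes hit  = hit
... | no miss = contradiction
  (λ {i} {i′} eq → f-injective (punchOut-injective (miss ∘ (i ,_) ∘ ≡.sym) (miss ∘ (i′ ,_) ∘ ≡.sym) eq))
  (<⇒notInjective {f = λ i → punchOut (miss ∘ (i ,_) ∘ ≡.sym)} (ℕ.n<1+n n))

%-absorbʳ-+ : ∀ a b d .{{_ : NonZero d}} → (a + b % d) % d ≡ (a + b) % d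
%-absorbʳ-+ a b d = begin
  (a + b % d) % d              ≡⟨ %-distribˡ-+ a (b % d) d ⟩
  (a % d + b % d % d) % d      ≡⟨ cong (λ r → (a % d + r) % d) (m%n%n≡m%n b d) ⟩
  (a % d + b % d) % d          ≡⟨ %-distribˡ-+ a b d ⟨
  (a + b) % d                  ∎
  where open ≡.≡-Reasoning

+ₘ-mod : ∀ {d} .{{_ : NonZero d}} (i : Fin d) m → i +ₘ (m mod d) ≡ (toℕ i + m) mod d
+ₘ-mod {d} i m = toℕ-injective (begin
  toℕ (i +ₘ (m mod d))         ≡⟨ toℕ-fromℕ< _ ⟩
  (toℕ i + toℕ (m mod d)) % d  ≡⟨ cong (λ r → (toℕ i + r) % d) (toℕ-fromℕ< _) ⟩
  (toℕ i + m % d) % d          ≡⟨ %-absorbʳ-+ (toℕ i) m d ⟩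
  (toℕ i + m) % d              ≡⟨ toℕ-fromℕ< _ ⟨
  toℕ ((toℕ i + m) mod d)      ∎)
  where open ≡.≡-Reasoning

module PrimeCyclic {c ℓ} (G : Group c ℓ) {p} .{{_ : NonZero p}} (p-prime : Prime p) (G'≅ℤₚ : G'≅ℤ G p)
  where
  open Group G
  open GroupProperties G using (identityʳ-unique)
  open MonoidMult monoid using (×-congʳ; ×-homo-+) renaming (_×_ to _·_)
  open import Relation.Binary.Reasoning.Setoid setoid

  private
    φ : Fin p → Carrier
    φ = proj₁ G'≅ℤₚ
    φ-homo : ∀ i j → φ (i +ₘ j) ≈ φ i ∙ φ j
    φ-homo = proj₁ (proj₂ (proj₂ G'≅ℤₚ))
    φ-injective : ∀ i j → φ i ≈ φ j → i ≡ j
    φ-injective = proj₁ (proj₂ (proj₂ (proj₂ G'≅ℤₚ)))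
    φ-onto : ∀ g → InG' G g → ∃ λ i → φ i ≈ g
    φ-onto = proj₂ (proj₂ (proj₂ (proj₂ G'≅ℤₚ)))

    0ₚ : Fin p
    0ₚ = 0 mod p

    toℕ-0ₚ : toℕ 0ₚ ≡ 0
    toℕ-0ₚ = ≡.trans (toℕ-fromℕ< _) (m<n⇒m%n≡m (>-nonZero⁻¹ p))

    φ-0ₚ : φ 0ₚ ≈ ε
    φ-0ₚ = identityʳ-unique (φ 0ₚ) (φ 0ₚ) (begin
      φ 0ₚ ∙ φ 0ₚ    ≈⟨ φ-homo 0ₚ 0ₚ ⟨
      φ (0ₚ +ₘ 0ₚ)   ≡⟨ cong (λ m → φ ((m + m) mod p)) toℕ-0ₚ ⟩
      φ 0ₚ           ∎)

    p∣toℕ⇒φ≈ε : ∀ {i} → p ∣ toℕ i → φ i ≈ ε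
    p∣toℕ⇒φ≈ε {i} p∣i = trans (reflexive (cong φ (toℕ-injective i≡0))) φ-0ₚ
      where
      i≡0 : toℕ i ≡ toℕ 0ₚ
      i≡0 = ≡.trans (≡.sym (m<n⇒m%n≡m (toℕ<n i))) (≡.trans (n∣m⇒m%n≡0 (toℕ i) p p∣i) (≡.sym toℕ-0ₚ))

    φ≈ε⇒p∣ : ∀ m → φ (m mod p) ≈ ε → p ∣ m
    φ≈ε⇒p∣ m φ≈ε = m%n≡0⇒n∣m m p
      (≡.trans (≡.sym (toℕ-fromℕ< _))
        (≡.trans (cong toℕ (φ-injective _ 0ₚ (trans φ≈ε (sym φ-0ₚ)))) toℕ-0ₚ))

    φ-mod : ∀ i d → φ ((d * toℕ i) mod p) ≈ d · φ i
    φ-mod i zero    = φ-0ₚ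
    φ-mod i (suc d) = begin
      φ ((toℕ i + d * toℕ i) mod p)  ≡⟨ cong φ (+ₘ-mod i (d * toℕ i)) ⟨
      φ (i +ₘ ((d * toℕ i) mod p))   ≈⟨ φ-homo i _ ⟩
      φ i ∙ φ ((d * toℕ i) mod p)    ≈⟨ ∙-congˡ (φ-mod i d) ⟩
      φ i ∙ d · φ i                  ∎

    -- p is prime, so a nonzero residue times a residue below p is nonzero mod p.
    ·≉ε : ∀ {x} → InG' G x → ¬ x ≈ ε → ∀ {d} → 0 < d → d < p → ¬ d · x ≈ ε
    ·≉ε {x} x∈G' x≉ε {suc d} _ d<p dx≈ε with φ-onto x x∈G'
    ... | i , φi≈x = [ >⇒∤ d<p , x≉ε ∘ x≈ε ] (euclidsLemma (suc d) (toℕ i) p-prime (φ≈ε⇒p∣ _ φ≈ε))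
      where
      φ≈ε : φ ((suc d * toℕ i) mod p) ≈ ε
      φ≈ε = trans (φ-mod i (suc d)) (trans (×-congʳ (suc d) φi≈x) dx≈ε)
      x≈ε : p ∣ toℕ i → x ≈ ε
      x≈ε = trans (sym φi≈x) ∘ p∣toℕ⇒φ≈ε

    ·-distinct : ∀ {x} → InG' G x → ¬ x ≈ ε → ∀ {k k′} → k < k′ → k′ < p → ¬ k · x ≈ k′ · x
    ·-distinct {x} x∈G' x≉ε {k} {k′} k<k′ k′<p kx≈k′x =
      ·≉ε x∈G' x≉ε (ℕ.m<n⇒0<n∸m k<k′) (ℕ.≤-<-trans (ℕ.m∸n≤m k′ k) k′<p)
        (identityʳ-unique (k · x) _ (sym (begin
          k · x                    ≈⟨ kx≈k′x ⟩
          k′ · x                   ≡⟨ cong (_· x) (ℕ.m+[n∸m]≡n (ℕ.<⇒≤ k<k′)) ⟨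
          (k + (k′ ∸ k)) · x       ≈⟨ ×-homo-+ x k (k′ ∸ k) ⟩
          k · x ∙ (k′ ∸ k) · x     ∎)))

  ≈ε? : ∀ {g} → InG' G g → Dec (g ≈ ε)
  ≈ε? {g} g∈G' with φ-onto g g∈G'
  ... | i , φi≈g = Dec.map′ (λ i≡0ₚ → trans (sym φi≈g) (trans (reflexive (cong φ i≡0ₚ)) φ-0ₚ))
                            (λ g≈ε → φ-injective i 0ₚ (trans φi≈g (trans g≈ε (sym φ-0ₚ))))
                            (i ≟ 0ₚ)

  ·-injective : ∀ {x} → InG' G x → ¬ x ≈ ε → ∀ {k k′} → k < p → k′ < p → k · x ≈ k′ · x → k ≡ k′
  ·-injective x∈G' x≉ε {k} {k′} k<p k′<p kx≈k′x with ℕ.<-cmp k k′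
  ... | tri< k<k′ _ _ = contradiction kx≈k′x (·-distinct x∈G' x≉ε k<k′ k′<p)
  ... | tri≈ _ k≡k′ _ = k≡k′
  ... | tri> _ _ k′<k = contradiction (sym kx≈k′x) (·-distinct x∈G' x≉ε k′<k k<p)

  ·-onto : ∀ {x} → InG' G x → ¬ x ≈ ε → ∀ {g} → InG' G g → ∃ λ k → k < p × g ≈ k · x
  ·-onto {x} x∈G' x≉ε {g} g∈G' =
    let j , φj≈g      = φ-onto g g∈G'
        k , index-k≡j = injective⇒surjective index index-injective j
    in toℕ k , toℕ<n k , (begin
      g                ≈⟨ φj≈g ⟨
      φ j              ≡⟨ cong φ index-k≡j ⟨
      φ (index k)      ≈⟨ φ-index k ⟩
      toℕ k · x        ∎)
    where
    index : Fin p → Fin p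
    index k = proj₁ (φ-onto (toℕ k · x) (·-G' G x∈G' (toℕ k)))
    φ-index : ∀ k → φ (index k) ≈ toℕ k · x
    φ-index k = proj₂ (φ-onto (toℕ k · x) (·-G' G x∈G' (toℕ k)))
    index-injective : Injective _≡_ _≡_ index
    index-injective {k} {k′} eq = toℕ-injective (·-injective x∈G' x≉ε (toℕ<n k) (toℕ<n k′)
      (trans (sym (φ-index k)) (trans (reflexive (cong φ eq)) (φ-index k′))))

module _ {c ℓ v e} {G : Group c ℓ} {X : Graph v e} (A : GGraph G X) where
  open Group G
  open GGraph A
  open Setup A

  act-\\ : ∀ {g g′ y y′} → act g y ≡ act g′ y′ → act (g′ \\ g) y ≡ y′
  act-\\ {g} {g′} {y} {y′} gy≡g′y′ = begin
    act (g′ ⁻¹ ∙ g) y            ≡⟨ act-∙ (g′ ⁻¹) g y ⟩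
    act (g′ ⁻¹) (act g y)        ≡⟨ cong (act (g′ ⁻¹)) gy≡g′y′ ⟩
    act (g′ ⁻¹) (act g′ y′)      ≡⟨ act-∙ (g′ ⁻¹) g′ y′ ⟨
    act (g′ ⁻¹ ∙ g′) y′          ≡⟨ act-≈ (inverseˡ g′) y′ ⟩
    act ε y′                     ≡⟨ act-ε y′ ⟩
    y′                           ∎
    where open ≡.≡-Reasoning

  act≡⇒SameOrbit : ∀ {g g′ y y′} → InG' G g → InG' G g′ → act g y ≡ act g′ y′ → SameOrbit y y′
  act≡⇒SameOrbit g∈G' g′∈G' gy≡g′y′ = _ , g'-∙ (g'-⁻¹ g′∈G') g∈G' , act-\\ gy≡g′y′

  module _ {p} .{{_ : NonZero p}} (p-prime : Prime p) (G'≅ℤₚ : G'≅ℤ G p) (transitive : Transitive) where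
    open PrimeCyclic G p-prime G'≅ℤₚ
    open MonoidMult monoid using () renaming (_×_ to _·_)
    open GroupProperties G using (\\-leftDividesˡ)

    -- A nontrivial g ∈ G' generates G', so each conjugate t⁻¹ g t is a power of g and fixes y,
    -- i.e. g fixes t y; by transitivity g fixes every vertex.
    G'-semiregular : ∀ {g y} → InG' G g → act g y ≡ y → g ≈ ε
    G'-semiregular {g} {y} g∈G' gy≡y with ≈ε? g∈G'
    ... | yes g≈ε = g≈ε
    ... | no  g≉ε = faithful g fixes
      where
      powers-fix : ∀ k → act (k · g) y ≡ y
      powers-fix zero    = act-ε y
      powers-fix (suc k) = ≡.trans (act-∙ g (k · g) y) (≡.trans (cong (act g) (powers-fix k)) gy≡y)
      fixes : ∀ z → act g z ≡ z
      fixes z with transitive y z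
      ... | t , ≡.refl with ·-onto g∈G' g≉ε (conjugate-G' G g∈G' t)
      ... | k , _ , t⁻¹gt≈k·g = begin
        act g (act t y)                  ≡⟨ act-∙ g t y ⟨
        act (g ∙ t) y                    ≡⟨ act-≈ (\\-leftDividesˡ t (g ∙ t)) y ⟨
        act (t ∙ (t \\ (g ∙ t))) y       ≡⟨ act-∙ t _ y ⟩
        act t (act (t \\ (g ∙ t)) y)     ≡⟨ cong (act t) (≡.trans (act-≈ t⁻¹gt≈k·g y) (powers-fix k)) ⟩
        act t y                          ∎
        where open ≡.≡-Reasoning

    act-G'-injective : ∀ {g g′ y} → InG' G g → InG' G g′ → act g y ≡ act g′ y → g ≈ g′
    act-G'-injective g∈G' g′∈G' gy≡g′y =
      \\≈ε⇒≈ G (G'-semiregular (g'-∙ (g'-⁻¹ g′∈G') g∈G') (act-\\ gy≡g′y))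

module Ladder {o ℓ v e} {G : Group o ℓ} {X : Graph v e} (A : GGraph G X)
  {p} .{{_ : NonZero p}} (p-prime : Prime p) (G'≅ℤₚ : G'≅ℤ G p) (transitive : Setup.Transitive A)
  (col : ℕ → Graph.V X) (n : ℕ)
  (col-adjacent : ∀ {t} → t < n → Graph.E X (col t) (col (suc t)))
  (col-orbits-distinct : ∀ {t t′} → t ≤ n → t′ ≤ n → Setup.SameOrbit A (col t) (col t′) → t ≡ t′)
  {h h′ : Group.Carrier G} (h∈G' : InG' G h) (h′∈G' : InG' G h′) (h≉h′ : ¬ Group._≈_ G h h′)
  (rung : Graph.E X (GGraph.act A h (col 0)) (GGraph.act A h′ (col n)))
  {x : Group.Carrier G} (x∈G' : InG' G x)
  where
  open Group G
  open Graph X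
  open GGraph A
  open Setup A
  open PrimeCyclic G p-prime G'≅ℤₚ using (·-onto; ·-injective)
  open GroupProperties G using (\\-leftDividesˡ; //-rightDividesˡ; ∙-cancelˡ)
  open MonoidMult monoid using () renaming (_×_ to _·_)
  open import Relation.Binary.Reasoning.Setoid setoid

  c : Carrier
  c = h′ \\ h

  c∈G' : InG' G c
  c∈G' = g'-∙ (g'-⁻¹ h′∈G') h∈G'

  c≉ε : ¬ c ≈ ε
  c≉ε = h≉h′ ∘ \\≈ε⇒≈ G

  row∈G' : ∀ k → InG' G (x ∙ k · c)
  row∈G' k = g'-∙ x∈G' (·-G' G c∈G' k)

  cell : ℕ → ℕ → V
  cell k t = act (x ∙ k · c) (col t)

  ladder : List V
  ladder = rowMajor cell p n

  InColumns : V → Set _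
  InColumns y = ∃ λ t → t ≤ n × SameOrbit (col t) y

  head-ladder : head ladder ≡ just (act x (col 0))
  head-ladder = ≡.trans (head-rowMajor cell n p) (cong just (act-≈ (identityʳ x) (col 0)))

  last-ladder : last ladder ≡ just (cell (pred p) n)
  last-ladder = last-rowMajor cell n p

  cell-InColumns : ∀ k {t} → t ≤ n → InColumns (cell k t)
  cell-InColumns k {t} t≤n = t , t≤n , x ∙ k · c , row∈G' k , ≡.refl

  InColumns⇒cell : ∀ {y} → InColumns y → ∃₂ λ k t → k < p × t ≤ n × y ≡ cell k t
  InColumns⇒cell (t , t≤n , g , g∈G' , ≡.refl) with ·-onto c∈G' c≉ε (g'-∙ (g'-⁻¹ x∈G') g∈G')
  ... | k , k<p , x⁻¹g≈kc =
    k , t , k<p , t≤n , act-≈ (trans (sym (\\-leftDividesˡ x g)) (∙-congˡ x⁻¹g≈kc)) (col t)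

  cell-injective : ∀ {k k′ t t′} → k < p → k′ < p → t ≤ n → t′ ≤ n →
                   cell k t ≡ cell k′ t′ → k ≡ k′ × t ≡ t′
  cell-injective {k} {k′} k<p k′<p t≤n t′≤n eq
    with col-orbits-distinct t≤n t′≤n (act≡⇒SameOrbit A (row∈G' k) (row∈G' k′) eq)
  ... | ≡.refl = ·-injective c∈G' c≉ε k<p k′<p (∙-cancelˡ x _ _ rows≈) , ≡.refl
    where
    rows≈ : x ∙ k · c ≈ x ∙ k′ · c
    rows≈ = act-G'-injective A p-prime G'≅ℤₚ transitive (row∈G' k) (row∈G' k′) eq

  along : ∀ k {t} → t < n → E (cell k t) (cell k (suc t))
  along k t<n = act-adj (x ∙ k · c) (col-adjacent t<n)

  -- Moving the rung by x cᵏ h′⁻¹ joins the end of row k to the start of row k + 1.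
  down : ∀ k → E (cell k n) (cell (suc k) 0)
  down k = E-sym (subst₂ E (act-∘ rowStart) (act-∘ rowEnd) (act-adj g rung))
    where
    g : Carrier
    g = (x ∙ k · c) // h′
    rowStart : g ∙ h ≈ x ∙ suc k · c
    rowStart = begin
      ((x ∙ k · c) // h′) ∙ h   ≈⟨ assoc _ _ _ ⟩
      (x ∙ k · c) ∙ c           ≈⟨ assoc _ _ _ ⟩
      x ∙ (k · c ∙ c)           ≈⟨ ∙-congˡ (·-sucʳ G c k) ⟨
      x ∙ suc k · c             ∎
    rowEnd : g ∙ h′ ≈ x ∙ k · c
    rowEnd = //-rightDividesˡ h′ (x ∙ k · c)
    act-∘ : ∀ {g₁ g₂ y} → g ∙ g₁ ≈ g₂ → act g (act g₁ y) ≡ act g₂ y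
    act-∘ {g₁} {y = y} gg₁≈g₂ = ≡.trans (≡.sym (act-∙ g g₁ y)) (act-≈ gg₁≈g₂ y)

  Unique-ladder : Unique ladder
  Unique-ladder = rowMajor-Unique cell n p cell-injective

  All-ladder : All InColumns ladder
  All-ladder = rowMajor-All cell n p (λ {k} _ → cell-InColumns k)

  ∈-ladder : ∀ {y} → InColumns y → y ∈ ladder
  ∈-ladder y∈cols with InColumns⇒cell y∈cols
  ... | k , t , k<p , t≤n , ≡.refl = ∈-rowMajor cell n k<p t≤n

  Linked-ladder : Linked E ladder
  Linked-ladder = rowMajor-Linked cell n p along down

private
  -i+[i+j]≡j : ∀ i j → ℤ.- i ℤ.+ (i ℤ.+ j) ≡ j
  -i+[i+j]≡j = solve-∀

  i+[j-i]≡j : ∀ i j → i ℤ.+ (j ℤ.- i) ≡ j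
  i+[j-i]≡j = solve-∀

  1+[i+j]≡i+[1+j] : ∀ i j → ℤ.1ℤ ℤ.+ (i ℤ.+ j) ≡ i ℤ.+ (ℤ.1ℤ ℤ.+ j)
  1+[i+j]≡i+[1+j] = solve-∀

≤⇒offset : ∀ {i j} → i ℤ.≤ j → ∃ λ n → j ≡ i ℤ.+ + n
≤⇒offset {i} {j} i≤j = ℤ.∣ j ℤ.- i ∣ ,
  ≡.sym (≡.trans (cong (ℤ._+_ i) (ℤ.0≤i⇒+∣i∣≡i (ℤ.i≤j⇒0≤j-i i≤j))) (i+[j-i]≡j i j))

offset-injective : ∀ i {m n} → i ℤ.+ + m ≡ i ℤ.+ + n → m ≡ n
offset-injective i {m} {n} eq = ℤ.+-injective
  (≡.trans (≡.sym (-i+[i+j]≡j i (+ m))) (≡.trans (cong (ℤ._+_ (ℤ.- i)) eq) (-i+[i+j]≡j i (+ n))))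

offset-cancel-≤ : ∀ i {m n} → i ℤ.+ + m ℤ.≤ i ℤ.+ + n → m ≤ n
offset-cancel-≤ i {m} {n} le =
  ℤ.drop‿+≤+ (subst₂ ℤ._≤_ (-i+[i+j]≡j i (+ m)) (-i+[i+j]≡j i (+ n)) (ℤ.+-monoʳ-≤ (ℤ.- i) le))

offset-suc : ∀ i n → ℤ.suc (i ℤ.+ + n) ≡ i ℤ.+ + suc n
offset-suc i n = 1+[i+j]≡i+[1+j] i (+ n)

module _ {c ℓ v e} {G : Group c ℓ} {X : Graph v e} (A : GGraph G X) where
  open Group G using (_≈_)
  open Graph X
  open GGraph A
  open Setup A

  module _ (w : ℤ → V) (a : ℤ) (n : ℕ) where

    InBlock⇒offset : ∀ {y} → InBlock w a (a ℤ.+ + n) y → ∃ λ t → t ≤ n × SameOrbit (w (a ℤ.+ + t)) y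
    InBlock⇒offset (i , a≤i , i≤a+n , orbit) with ≤⇒offset a≤i
    ... | t , ≡.refl = t , offset-cancel-≤ a i≤a+n , orbit

    offset⇒InBlock : ∀ {y} → (∃ λ t → t ≤ n × SameOrbit (w (a ℤ.+ + t)) y) → InBlock w a (a ℤ.+ + n) y
    offset⇒InBlock (t , t≤n , orbit) = a ℤ.+ + t , ℤ.i≤i+j a (+ t) , ℤ.+-monoʳ-≤ a (ℤ.+≤+ t≤n) , orbit

  blockHamPath : ∀ {p} .{{_ : NonZero p}} → Prime p → Transitive → G'≅ℤ G p →
    ∀ {w} → LiftedHamPath w → ∀ {a b} → a ℤ.≤ b →
    ∀ {h h′} → InG' G h → InG' G h′ → ¬ h ≈ h′ → E (act h (w a)) (act h′ (w b)) →
    ∀ u → SameOrbit (w a) u → BlockHamPath w a b u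
  blockHamPath {p} p-prime transitive G'≅ℤₚ {w} (_ , orbits-distinct , adjacent) {a} a≤b
               {h} {h′} h∈G' h′∈G' h≉h′ rung u (x , x∈G' , ≡.refl) with ≤⇒offset a≤b
  ... | n , ≡.refl =
    ladder , cell (pred p) n , head-ladder′ , last-ladder , (_ , row∈G' (pred p) , ≡.refl) ,
    Unique-ladder , All.map (offset⇒InBlock w a n) All-ladder , (λ _ → ∈-ladder ∘ InBlock⇒offset w a n) ,
    Linked-ladder
    where
    col : ℕ → V
    col t = w (a ℤ.+ + t)

    col-0 : col 0 ≡ w a
    col-0 = cong w (ℤ.+-identityʳ a)

    col-adjacent : ∀ {t} → t < n → E (col t) (col (suc t))
    col-adjacent {t} _ = subst (E (col t) ∘ w) (offset-suc a t) (adjacent (a ℤ.+ + t))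

    col-orbits-distinct : ∀ {t t′} → t ≤ n → t′ ≤ n → SameOrbit (col t) (col t′) → t ≡ t′
    col-orbits-distinct _ _ orbit = offset-injective a (orbits-distinct _ _ orbit)

    rung′ : E (act h (col 0)) (act h′ (col n))
    rung′ = subst (λ y → E (act h y) (act h′ (col n))) (≡.sym col-0) rung

    open Ladder A p-prime G'≅ℤₚ transitive col n col-adjacent col-orbits-distinct
                h∈G' h′∈G' h≉h′ rung′ x∈G'

    head-ladder′ : head ladder ≡ just (act x (w a))
    head-ladder′ = ≡.trans head-ladder (cong (just ∘ act x) col-0)

mainTheorem12 : ∀ {c ℓ v e} (p : ℕ) .{{_ : NonZero p}} → Prime p →
    (G : Group c ℓ) (X : Graph v e) (A : GGraph G X) →
    Infinite X → Setup.Transitive A → G'≅ℤ G p →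
    (w : ℤ → Graph.V X) → Setup.LiftedHamPath A w →
    (a b : ℤ → ℤ) → Setup.Aligned A w a b →
    (∀ l → Σ (Group.Carrier G) λ h → Σ (Group.Carrier G) λ h' →
    InG' G h × InG' G h' × ¬ (Group._≈_ G h h') ×
    Graph.E X (GGraph.act A h (w (a l))) (GGraph.act A h' (w (b l)))) →
    ∀ l u → Setup.SameOrbit A (w (a l)) u → Setup.BlockHamPath A w (a l) (b l) u
mainTheorem12 p p-prime G X A _ transitive G'≅ℤₚ w lifted a b aligned rungs l =
  let _ , h∈G' , h′∈G' , h≉h′ , rung = proj₂ (rungs l)
  in blockHamPath A p-prime transitive G'≅ℤₚ lifted (ℤ.<⇒≤ (proj₁ (proj₂ (aligned l))))
                  h∈G' h′∈G' h≉h′ rung
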